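{- Let $T$ be a plane rooted tree and write $Q(T)=c_0+c_1q+\dots+c_Nq^N$ with $N=\deg Q(T)$. Then $c_i=c_{N-i}$ for all $0\le i\le N$, i.e. $Q(T)$ is palindromic.
   Context: A plane rooted tree is a finite tree with a distinguished vertex (the root), embedded in the plane so that it grows upward from the root. A leaf is a vertex of degree $1$ different from the root. For a leaf $v$ of $T$, $r(T,v)$ denotes the number of edges of $T$ lying to the right of the unique path connecting $v$ with the root, and $T-v$ is the plane rooted tree obtained by deleting $v$ and its incident edge. The plucking polynomial $Q(T)\in\mathbb{Z}[q]$ is defined recursively: if $T$ has a single vertex then $Q(T)=1$; otherwise $Q(T)=\sum_{v \text{ leaf of } T} q^{r(T,v)}Q(T-v)$. -}

module Defs where

open import Data.Nat using (ℕ; zero; suc; _+_; _<_; _≤_; _∸_)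
open import Data.Integer using (ℤ; 0ℤ; 1ℤ) renaming (_+_ to _+ℤ_)
open import Data.List using (List; []; _∷_; _++_; map; replicate; foldr)
open import Data.Product using (_×_; _,_)
open import Relation.Binary.PropositionalEquality using (_≡_; _≢_)

-- Plane rooted trees: a vertex together with the left-to-right ordered
-- list of its children (subtrees growing upward).
data Tree : Set where
  node : List Tree → Tree

mutual
  size : Tree → ℕ
  size (node ts) = suc (sizeF ts)

  sizeF : List Tree → ℕ
  sizeF []       = 0
  sizeF (t ∷ ts) = size t + sizeF ts

edges : Tree → ℕ
edges (node ts) = sizeF ts

-- Polynomials in ℤ[q] as coefficient lists (index i = coefficient of q^i).
Poly : Set
Poly = List ℤ

_⊕_ : Poly → Poly → Poly
[]       ⊕ q        = q
p        ⊕ []       = p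
(a ∷ p)  ⊕ (b ∷ q)  = (a +ℤ b) ∷ (p ⊕ q)

shift : ℕ → Poly → Poly
shift k p = replicate k 0ℤ ++ p

one : Poly
one = 1ℤ ∷ []

coeff : Poly → ℕ → ℤ
coeff []      _       = 0ℤ
coeff (a ∷ p) zero    = a
coeff (a ∷ p) (suc i) = coeff p i

IsDegree : Poly → ℕ → Set
IsDegree p N = (coeff p N ≢ 0ℤ) × (∀ i → N < i → coeff p i ≡ 0ℤ)

-- Given the (left-to-right) list of children subtrees of some vertex, list
-- every way of deleting a leaf lying in one of these subtrees, as pairs
-- (r , resulting list of children), where r counts the edges inside this
-- forest (including the edges joining the subtree roots to the common parent)
-- lying to the right of the path from the leaf down to the parent.
-- Every leaf of a tree (node ts) lies in one of the subtrees ts (the root is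
-- never a leaf), and the edges right of the path to the root are exactly the
-- sum over the vertices w on the path (excluding the root) of the number of
-- vertices in the subtrees of the right siblings of w.
plucksF : List Tree → List (ℕ × List Tree)
plucksF []                  = []
plucksF (node [] ∷ ts)      =
  (sizeF ts , ts) ∷ map (λ { (r , ts') → (r , node [] ∷ ts') }) (plucksF ts)
plucksF (node (c ∷ cs) ∷ ts) =
  map (λ { (r , cs') → (r + sizeF ts , node cs' ∷ ts) }) (plucksF (c ∷ cs))
  ++ map (λ { (r , ts') → (r , node (c ∷ cs) ∷ ts') }) (plucksF ts)

plucks : Tree → List (ℕ × Tree)
plucks (node ts) = map (λ { (r , ts') → (r , node ts') }) (plucksF ts)

-- Plucking polynomial, computed with fuel (the number of edges decreases by
-- one at each deletion, so fuel = edges T suffices).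
Qfuel : ℕ → Tree → Poly
Qfuel zero    _         = one
Qfuel (suc n) (node []) = one
Qfuel (suc n) (node (t ∷ ts)) =
  foldr (λ { (r , T') acc → shift r (Qfuel n T') ⊕ acc }) [] (plucks (node (t ∷ ts)))

Q : Tree → Poly
Q T = Qfuel (edges T) T

module Submission where

-- Q(T) has nonnegative coefficients, so we represent it by the multiset of
-- its exponents: a list of naturals up to permutation (_↭_), in which
-- exponent i occurs as often as the coefficient of q^i.  Products of
-- polynomials become the multiset of pairwise sums (_⊗_) and multiplication
-- by q^r becomes map (r +_).

open import Defs
open import Data.Nat using (ℕ; zero; suc; _+_; _*_; _∸_; _≤_; _<_; pred; z≤n; _≤?_)
open import Data.Nat.Properties
  using (_≟_; suc-injective; +-suc; +-assoc; +-comm; *-suc; ≤-refl; ≤-trans; ≤-antisym; ≰⇒>;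
         n∸n≡0; m∸[m∸n]≡n; [m+n]∸[m+o]≡n∸o; +-∸-assoc; +-∸-comm; ∸-+-assoc;
         +-mono-≤; +-monoʳ-≤; *-monoʳ-≤; n≤1+n; *-zeroʳ)
open import Data.Integer using (0ℤ) renaming (+_ to pos; _+_ to _+ℤ_)
open import Data.Integer.Properties using (+-identityˡ; +-identityʳ; pos-+; +-injective)
open import Data.List
  using (List; []; _∷_; _++_; map; foldr; concat; concatMap; cartesianProductWith; filter; length)
open import Data.List.Properties
  using (map-id; map-∘; map-cong; map-cong-local; map-++; length-++; ++-identityʳ; ++-assoc; concatMap-++;
         filter-accept; filter-reject; filter-++; filter-none; filter-some)
open import Data.List.Relation.Unary.All as All using (All; []; _∷_)
import Data.List.Relation.Unary.All.Properties as AllP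
open import Data.List.Relation.Unary.Any using (here)
open import Data.List.Membership.Propositional using (_∈_)
open import Data.List.Membership.Propositional.Properties using (∈-++⁺ʳ; ∈-cartesianProductWith⁺)
open import Data.List.Relation.Binary.Permutation.Propositional
  using (_↭_; ↭-refl; ↭-sym; ↭-trans; ↭-reflexive; prep; swap; module PermutationReasoning)
  renaming (refl to ↭-base; trans to ↭-step)
open import Data.List.Relation.Binary.Permutation.Propositional.Properties
  using (++⁺; ++⁺ˡ; ++⁺ʳ; map⁺; shifts; All-resp-↭; ∈-resp-↭; ↭-length; filter-↭)
  renaming (++-assoc to ↭-++-assoc)
open import Data.Product using (_×_; _,_; proj₂; ∃)
open import Function using (_∘_)
open import Relation.Nullary using (yes; no; contradiction)
open import Relation.Binary.PropositionalEquality

count : ℕ → List ℕ → ℕ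
count i = length ∘ filter (i ≟_)

count-here : ∀ {i x} M → i ≡ x → count i (x ∷ M) ≡ suc (count i M)
count-here {i} M i≡x = cong length (filter-accept (i ≟_) i≡x)

count-there : ∀ {i x} M → i ≢ x → count i (x ∷ M) ≡ count i M
count-there {i} M i≢x = cong length (filter-reject (i ≟_) i≢x)

count-++ : ∀ i X Y → count i (X ++ Y) ≡ count i X + count i Y
count-++ i X Y = trans (cong length (filter-++ (i ≟_) X Y)) (length-++ (filter (i ≟_) X))

count-resp-↭ : ∀ i {X Y} → X ↭ Y → count i X ≡ count i Y
count-resp-↭ i X↭Y = ↭-length (filter-↭ (i ≟_) X↭Y)

count-absent : ∀ {i} M → All (i ≢_) M → count i M ≡ 0
count-absent {i} M i∉M = cong length (filter-none (i ≟_) i∉M)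

count-present : ∀ {i M} → i ∈ M → count i M ≢ 0
count-present {i} i∈M count≡0 = contradiction (subst (0 <_) count≡0 (filter-some (i ≟_) i∈M)) λ ()

count-map-suc : ∀ i M → count (suc i) (map suc M) ≡ count i M
count-map-suc i [] = refl
count-map-suc i (x ∷ M) with i ≟ x
... | yes i≡x = begin
  count (suc i) (suc x ∷ map suc M) ≡⟨ count-here (map suc M) (cong suc i≡x) ⟩
  suc (count (suc i) (map suc M))   ≡⟨ cong suc (count-map-suc i M) ⟩
  suc (count i M)                   ≡⟨ count-here M i≡x ⟨
  count i (x ∷ M)                   ∎
  where open ≡-Reasoning
... | no i≢x = begin
  count (suc i) (suc x ∷ map suc M) ≡⟨ count-there (map suc M) (i≢x ∘ suc-injective) ⟩
  count (suc i) (map suc M)         ≡⟨ count-map-suc i M ⟩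
  count i M                         ≡⟨ count-there M i≢x ⟨
  count i (x ∷ M)                   ∎
  where open ≡-Reasoning

count-zero-map-suc : ∀ M → count 0 (map suc M) ≡ 0
count-zero-map-suc M = count-absent (map suc M) (AllP.map⁺ (All.universal (λ _ ()) M))

count-reflect : ∀ {D} M → All (_≤ D) M → ∀ {j} → j ≤ D → count j (map (D ∸_) M) ≡ count (D ∸ j) M
count-reflect [] [] j≤D = refl
count-reflect {D} (x ∷ M) (x≤D ∷ M≤D) {j} j≤D with D ∸ j ≟ x
... | yes D∸j≡x = begin
  count j (D ∸ x ∷ map (D ∸_) M) ≡⟨ count-here (map (D ∸_) M) j≡D∸x ⟩
  suc (count j (map (D ∸_) M))   ≡⟨ cong suc (count-reflect M M≤D j≤D) ⟩
  suc (count (D ∸ j) M)          ≡⟨ count-here M D∸j≡x ⟨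
  count (D ∸ j) (x ∷ M)          ∎
  where
  open ≡-Reasoning
  j≡D∸x : j ≡ D ∸ x
  j≡D∸x = trans (sym (m∸[m∸n]≡n j≤D)) (cong (D ∸_) D∸j≡x)
... | no D∸j≢x = begin
  count j (D ∸ x ∷ map (D ∸_) M) ≡⟨ count-there (map (D ∸_) M) j≢D∸x ⟩
  count j (map (D ∸_) M)         ≡⟨ count-reflect M M≤D j≤D ⟩
  count (D ∸ j) M                ≡⟨ count-there M D∸j≢x ⟨
  count (D ∸ j) (x ∷ M)          ∎
  where
  open ≡-Reasoning
  j≢D∸x : j ≢ D ∸ x
  j≢D∸x j≡D∸x = D∸j≢x (trans (cong (D ∸_) j≡D∸x) (m∸[m∸n]≡n x≤D))

record Represents (P : Poly) (M : List ℕ) : Set where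
  constructor represents
  field coeff≡count : ∀ i → coeff P i ≡ pos (count i M)
open Represents

represents-one : Represents one (0 ∷ [])
represents-one = represents λ { zero → refl ; (suc i) → refl }

represents-⊕ : ∀ {P P' M M'} → Represents P M → Represents P' M' → Represents (P ⊕ P') (M ++ M')
represents-⊕ {P} {P'} {M} {M'} P~M P'~M' = represents λ i → begin
  coeff (P ⊕ P') i                    ≡⟨ coeff-⊕ P P' i ⟩
  coeff P i +ℤ coeff P' i             ≡⟨ cong₂ _+ℤ_ (coeff≡count P~M i) (coeff≡count P'~M' i) ⟩
  pos (count i M) +ℤ pos (count i M') ≡⟨ pos-+ (count i M) (count i M') ⟨
  pos (count i M + count i M')        ≡⟨ cong pos (count-++ i M M') ⟨
  pos (count i (M ++ M'))             ∎
  where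
  open ≡-Reasoning
  coeff-⊕ : ∀ p q i → coeff (p ⊕ q) i ≡ coeff p i +ℤ coeff q i
  coeff-⊕ []      q       i       = sym (+-identityˡ (coeff q i))
  coeff-⊕ (a ∷ p) []      i       = sym (+-identityʳ (coeff (a ∷ p) i))
  coeff-⊕ (a ∷ p) (b ∷ q) zero    = refl
  coeff-⊕ (a ∷ p) (b ∷ q) (suc i) = coeff-⊕ p q i

represents-shift : ∀ r {P M} → Represents P M → Represents (shift r P) (map (r +_) M)
represents-shift zero    {M = M} P~M =
  represents λ i → trans (coeff≡count P~M i) (cong (λ X → pos (count i X)) (sym (map-id M)))
represents-shift (suc r) {P} {M} P~M = represents shifted
  where
  map-suc-r : map (suc r +_) M ≡ map suc (map (r +_) M)
  map-suc-r = map-∘ M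
  shifted : ∀ i → coeff (0ℤ ∷ shift r P) i ≡ pos (count i (map (suc r +_) M))
  shifted zero    = sym (cong pos (trans (cong (count 0) map-suc-r) (count-zero-map-suc (map (r +_) M))))
  shifted (suc i) = trans (coeff≡count (represents-shift r P~M) i)
    (sym (cong pos (trans (cong (count (suc i)) map-suc-r) (count-map-suc i (map (r +_) M)))))

pluckTerm : (List Tree → List ℕ) → ℕ × List Tree → List ℕ
pluckTerm E (r , ts') = map (r +_) (E ts')

exponentsFuel : ℕ → List Tree → List ℕ
exponentsFuel zero    _        = 0 ∷ []
exponentsFuel (suc n) []       = 0 ∷ []
exponentsFuel (suc n) (t ∷ ts) = concatMap (pluckTerm (exponentsFuel n)) (plucksF (t ∷ ts))

-- Σ q^r Qfuel n (node ts') over a list of plucks, written exactly as Qfuel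
-- computes it, so that Qfuel (suc n) (node (t ∷ ts)) unfolds to it.
pluckSum : ℕ → List (ℕ × List Tree) → Poly
pluckSum n L =
  foldr (λ { (r , T') acc → shift r (Qfuel n T') ⊕ acc }) [] (map (λ { (r , ts') → (r , node ts') }) L)

represents-pluckSum : ∀ n → (∀ ts → Represents (Qfuel n (node ts)) (exponentsFuel n ts)) →
                      ∀ L → Represents (pluckSum n L) (concatMap (pluckTerm (exponentsFuel n)) L)
represents-pluckSum n Q~E []              = represents λ i → refl
represents-pluckSum n Q~E ((r , ts') ∷ L) =
  represents-⊕ (represents-shift r (Q~E ts')) (represents-pluckSum n Q~E L)

represents-Qfuel : ∀ n ts → Represents (Qfuel n (node ts)) (exponentsFuel n ts)
represents-Qfuel zero    ts       = represents-one
represents-Qfuel (suc n) []       = represents-one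
represents-Qfuel (suc n) (t ∷ ts) = represents-pluckSum n (represents-Qfuel n) (plucksF (t ∷ ts))

expsF : List Tree → List ℕ
expsF ts = exponentsFuel (sizeF ts) ts

exps : Tree → List ℕ
exps (node ts) = expsF ts

plucksF-size : ∀ ts → All (λ p → sizeF ts ≡ suc (sizeF (proj₂ p))) (plucksF ts)
plucksF-size []                   = []
plucksF-size (node [] ∷ ts)       = refl ∷ AllP.map⁺ (All.map (cong suc) (plucksF-size ts))
plucksF-size (node (c ∷ cs) ∷ ts) = AllP.++⁺
  (AllP.map⁺ (All.map (cong (λ k → suc (k + sizeF ts))) (plucksF-size (c ∷ cs))))
  (AllP.map⁺ (All.map (λ {p} eq → trans (cong (size (node (c ∷ cs)) +_) eq)
                                        (+-suc (size (node (c ∷ cs))) (sizeF (proj₂ p))))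
                      (plucksF-size ts)))

-- The defining recursion of Q in terms of exponent multisets: the fuel
-- sizeF ts' of each plucked forest is one less than that of the whole forest.
expsF-unfold : ∀ cs ts → expsF (node cs ∷ ts) ≡ concatMap (pluckTerm expsF) (plucksF (node cs ∷ ts))
expsF-unfold cs ts = cong concat (map-cong-local (All.map sameFuel (plucksF-size (node cs ∷ ts))))
  where
  sameFuel : ∀ {p} → sizeF (node cs ∷ ts) ≡ suc (sizeF (proj₂ p)) →
             pluckTerm (exponentsFuel (sizeF cs + sizeF ts)) p ≡ pluckTerm expsF p
  sameFuel {r , ts'} eq = cong (λ n → map (r +_) (exponentsFuel n ts')) (suc-injective eq)

infixr 7 _⊗_
_⊗_ : List ℕ → List ℕ → List ℕ
_⊗_ = cartesianProductWith _+_

⊗-identityˡ : ∀ Y → (0 ∷ []) ⊗ Y ≡ Y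
⊗-identityˡ Y = trans (++-identityʳ (map (0 +_) Y)) (map-id Y)

⊗-zeroʳ : ∀ X → X ⊗ [] ≡ []
⊗-zeroʳ []      = refl
⊗-zeroʳ (x ∷ X) = ⊗-zeroʳ X

⊗-distribʳ : ∀ X Y C → (X ++ Y) ⊗ C ≡ X ⊗ C ++ Y ⊗ C
⊗-distribʳ []      Y C = refl
⊗-distribʳ (x ∷ X) Y C = trans (cong (map (x +_) C ++_) (⊗-distribʳ X Y C))
                               (sym (++-assoc (map (x +_) C) (X ⊗ C) (Y ⊗ C)))

++-interchange : (P Q R S : List ℕ) → (P ++ Q) ++ (R ++ S) ↭ (P ++ R) ++ (Q ++ S)
++-interchange P Q R S = begin
  (P ++ Q) ++ (R ++ S) ↭⟨ ↭-++-assoc P Q (R ++ S) ⟩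
  P ++ (Q ++ (R ++ S)) ↭⟨ ++⁺ˡ P (shifts Q R) ⟩
  P ++ (R ++ (Q ++ S)) ↭⟨ ↭-++-assoc P R (Q ++ S) ⟨
  (P ++ R) ++ (Q ++ S) ∎
  where open PermutationReasoning

⊗-distribˡ : ∀ A X Y → A ⊗ (X ++ Y) ↭ A ⊗ X ++ A ⊗ Y
⊗-distribˡ []      X Y = ↭-refl
⊗-distribˡ (a ∷ A) X Y = begin
  map (a +_) (X ++ Y) ++ A ⊗ (X ++ Y)                ≡⟨ cong (_++ A ⊗ (X ++ Y)) (map-++ (a +_) X Y) ⟩
  (map (a +_) X ++ map (a +_) Y) ++ A ⊗ (X ++ Y)     ↭⟨ ++⁺ˡ _ (⊗-distribˡ A X Y) ⟩
  (map (a +_) X ++ map (a +_) Y) ++ (A ⊗ X ++ A ⊗ Y)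
    ↭⟨ ++-interchange (map (a +_) X) (map (a +_) Y) (A ⊗ X) (A ⊗ Y) ⟩
  (map (a +_) X ++ A ⊗ X) ++ (map (a +_) Y ++ A ⊗ Y) ∎
  where open PermutationReasoning

⊗-congˡ : ∀ {X X'} C → X ↭ X' → X ⊗ C ↭ X' ⊗ C
⊗-congˡ C ↭-base           = ↭-refl
⊗-congˡ C (prep x X↭X')    = ++⁺ˡ (map (x +_) C) (⊗-congˡ C X↭X')
⊗-congˡ C (swap x y X↭X')  =
  ↭-trans (shifts (map (x +_) C) (map (y +_) C))
          (++⁺ˡ (map (y +_) C) (++⁺ˡ (map (x +_) C) (⊗-congˡ C X↭X')))
⊗-congˡ C (↭-step X↭Y Y↭Z) = ↭-trans (⊗-congˡ C X↭Y) (⊗-congˡ C Y↭Z)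

⊗-congʳ : ∀ A {Y Y'} → Y ↭ Y' → A ⊗ Y ↭ A ⊗ Y'
⊗-congʳ []      Y↭Y' = ↭-refl
⊗-congʳ (a ∷ A) Y↭Y' = ++⁺ (map⁺ (a +_) Y↭Y') (⊗-congʳ A Y↭Y')

map-+-assoc : ∀ a b X → map ((a + b) +_) X ≡ map (a +_) (map (b +_) X)
map-+-assoc a b X = trans (map-cong (+-assoc a b) X) (map-∘ X)

map-+-exchange : ∀ a b c d X → a + b ≡ c + d → map (a +_) (map (b +_) X) ≡ map (c +_) (map (d +_) X)
map-+-exchange a b c d X a+b≡c+d = begin
  map (a +_) (map (b +_) X) ≡⟨ map-+-assoc a b X ⟨
  map ((a + b) +_) X        ≡⟨ cong (λ k → map (k +_) X) a+b≡c+d ⟩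
  map ((c + d) +_) X        ≡⟨ map-+-assoc c d X ⟩
  map (c +_) (map (d +_) X) ∎
  where open ≡-Reasoning

map-⊗ˡ : ∀ r X Y → map (r +_) (X ⊗ Y) ≡ map (r +_) X ⊗ Y
map-⊗ˡ r []      Y = refl
map-⊗ˡ r (x ∷ X) Y = trans (map-++ (r +_) (map (x +_) Y) (X ⊗ Y))
  (cong₂ _++_ (sym (map-+-assoc r x Y)) (map-⊗ˡ r X Y))

map-⊗ʳ : ∀ r X Y → map (r +_) (X ⊗ Y) ≡ X ⊗ map (r +_) Y
map-⊗ʳ r []      Y = refl
map-⊗ʳ r (x ∷ X) Y = trans (map-++ (r +_) (map (x +_) Y) (X ⊗ Y))
  (cong₂ _++_ (map-+-exchange r x x r Y (+-comm r x)) (map-⊗ʳ r X Y))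

record Additive (G : List ℕ → List ℕ) : Set where
  field
    resp-↭ : ∀ {X Y} → X ↭ Y → G X ↭ G Y
    ++-hom : ∀ X Y → G (X ++ Y) ↭ G X ++ G Y
    []-hom : G [] ≡ []
open Additive

additive-map : ∀ r → Additive (map (r +_))
additive-map r = record
  { resp-↭ = map⁺ (r +_) ; ++-hom = λ X Y → ↭-reflexive (map-++ (r +_) X Y) ; []-hom = refl }

additive-⊗ˡ : ∀ A → Additive (A ⊗_)
additive-⊗ˡ A = record { resp-↭ = ⊗-congʳ A ; ++-hom = ⊗-distribˡ A ; []-hom = ⊗-zeroʳ A }

additive-⊗ʳ : ∀ C → Additive (_⊗ C)
additive-⊗ʳ C = record
  { resp-↭ = ⊗-congˡ C ; ++-hom = λ X Y → ↭-reflexive (⊗-distribʳ X Y C) ; []-hom = refl }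

additive-∘ : ∀ {G H} → Additive G → Additive H → Additive (G ∘ H)
additive-∘ {G} {H} addG addH = record
  { resp-↭ = resp-↭ addG ∘ resp-↭ addH
  ; ++-hom = λ X Y → ↭-trans (resp-↭ addG (++-hom addH X Y)) (++-hom addG (H X) (H Y))
  ; []-hom = trans (cong G ([]-hom addH)) ([]-hom addG)
  }

concatMap-additive : ∀ {A B : Set} {G} → Additive G → (φ : A → B) (h : B → List ℕ) (g : A → List ℕ) →
                     ∀ L → All (λ p → h (φ p) ↭ G (g p)) L → concatMap h (map φ L) ↭ G (concatMap g L)
concatMap-additive addG φ h g []      []            = ↭-reflexive (sym ([]-hom addG))
concatMap-additive addG φ h g (p ∷ L) (hφp↭Ggp ∷ hL) =
  ↭-trans (++⁺ hφp↭Ggp (concatMap-additive addG φ h g L hL))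
          (↭-sym (++-hom addG (g p) (concatMap g L)))

-- The Gaussian binomial [a+b choose a]_q as an exponent multiset, defined by
-- the Pascal rule [a+b choose a] = q^b [a+b-1 choose a-1] + [a+b-1 choose a].
binom : ℕ → ℕ → List ℕ
binom zero    b       = 0 ∷ []
binom (suc a) zero    = 0 ∷ []
binom (suc a) (suc b) = map (suc b +_) (binom a (suc b)) ++ binom (suc a) b

binom-zeroʳ : ∀ a → binom a 0 ≡ 0 ∷ []
binom-zeroʳ zero    = refl
binom-zeroʳ (suc a) = refl

binom-pascalᵒ : ∀ a b → binom (suc a) (suc b) ↭ binom a (suc b) ++ map (suc a +_) (binom (suc a) b)
binom-pascalᵒ zero    zero    = swap _ _ ↭-refl
binom-pascalᵒ zero    (suc b) = ↭-trans (prep _ (binom-pascalᵒ zero b)) (swap _ _ ↭-refl)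
binom-pascalᵒ (suc a) zero    = begin
  map (1 +_) (binom (suc a) 1) ++ 0 ∷ []
    ↭⟨ ++⁺ʳ (0 ∷ []) (map⁺ (1 +_) (binom-pascalᵒ a zero)) ⟩
  map (1 +_) (binom a 1 ++ top ∷ []) ++ 0 ∷ []
    ≡⟨ cong (_++ 0 ∷ []) (map-++ (1 +_) (binom a 1) (top ∷ [])) ⟩
  (map (1 +_) (binom a 1) ++ 1 + top ∷ []) ++ 0 ∷ []
    ↭⟨ ↭-++-assoc (map (1 +_) (binom a 1)) (1 + top ∷ []) (0 ∷ []) ⟩
  map (1 +_) (binom a 1) ++ 1 + top ∷ 0 ∷ []
    ↭⟨ ++⁺ˡ (map (1 +_) (binom a 1)) (swap _ _ ↭-refl) ⟩
  map (1 +_) (binom a 1) ++ 0 ∷ 1 + top ∷ []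
    ↭⟨ ↭-++-assoc (map (1 +_) (binom a 1)) (0 ∷ []) (1 + top ∷ []) ⟨
  (map (1 +_) (binom a 1) ++ 0 ∷ []) ++ 1 + top ∷ [] ∎
  where
  open PermutationReasoning
  top = suc a + 0
binom-pascalᵒ (suc a) (suc b) = begin
  map (2 + b +_) (binom (suc a) (2 + b)) ++ binom (2 + a) (suc b)
    ↭⟨ ++⁺ (map⁺ (2 + b +_) (binom-pascalᵒ a (suc b))) (binom-pascalᵒ (suc a) b) ⟩
  map (2 + b +_) (binom a (2 + b) ++ map (suc a +_) Y) ++ (Y ++ Z)
    ≡⟨ cong (_++ (Y ++ Z)) (map-++ (2 + b +_) (binom a (2 + b)) (map (suc a +_) Y)) ⟩
  (map (2 + b +_) (binom a (2 + b)) ++ map (2 + b +_) (map (suc a +_) Y)) ++ (Y ++ Z)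
    ↭⟨ ++-interchange (map (2 + b +_) (binom a (2 + b))) (map (2 + b +_) (map (suc a +_) Y)) Y Z ⟩
  (map (2 + b +_) (binom a (2 + b)) ++ Y) ++ (map (2 + b +_) (map (suc a +_) Y) ++ Z)
    ≡⟨ cong (λ W → binom (suc a) (2 + b) ++ (W ++ Z))
            (map-+-exchange (2 + b) (suc a) (2 + a) (suc b) Y (cong (2 +_) (+-exchange b a))) ⟩
  binom (suc a) (2 + b) ++ (map (2 + a +_) (map (suc b +_) Y) ++ Z)
    ≡⟨ cong (binom (suc a) (2 + b) ++_) (map-++ (2 + a +_) (map (suc b +_) Y) (binom (2 + a) b)) ⟨
  binom (suc a) (2 + b) ++ map (2 + a +_) (binom (2 + a) (suc b)) ∎
  where
  open PermutationReasoning
  Y = binom (suc a) (suc b)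
  Z = map (2 + a +_) (binom (2 + a) b)
  +-exchange : ∀ m n → m + suc n ≡ n + suc m
  +-exchange m n = trans (+-suc m n) (trans (cong suc (+-comm m n)) (sym (+-suc n m)))

-- The leaves of node (t ∷ ts) lie either in the leftmost subtree t or in ts.
-- Plucking a leaf of t leaves all of ts to the right of its path; if t is
-- itself a leaf, plucking it deletes t.
plucksInHead : Tree → List Tree → List (ℕ × List Tree)
plucksInHead (node [])       ts = (sizeF ts , ts) ∷ []
plucksInHead (node (c ∷ cs)) ts = map (λ { (r , cs') → (r + sizeF ts , node cs' ∷ ts) }) (plucksF (c ∷ cs))

plucksInTail : Tree → List Tree → List (ℕ × List Tree)
plucksInTail t ts = map (λ { (r , ts') → (r , t ∷ ts') }) (plucksF ts)

plucksF-split : ∀ t ts → plucksF (t ∷ ts) ≡ plucksInHead t ts ++ plucksInTail t ts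
plucksF-split (node [])       ts = refl
plucksF-split (node (c ∷ cs)) ts = refl

ProductFormula : ℕ → Set
ProductFormula n = ∀ t ts → sizeF (t ∷ ts) ≡ n →
                   expsF (t ∷ ts) ↭ binom (size t) (sizeF ts) ⊗ (exps t ⊗ expsF ts)

headPart : ∀ {n} → ProductFormula n → ∀ cs ts → sizeF (node cs ∷ ts) ≡ suc n →
  concatMap (pluckTerm expsF) (plucksInHead (node cs) ts)
    ↭ map (sizeF ts +_) (binom (sizeF cs) (sizeF ts) ⊗ (expsF cs ⊗ expsF ts))
headPart _ [] ts _ = ↭-reflexive (begin
  map (sizeF ts +_) (expsF ts) ++ []                   ≡⟨ ++-identityʳ _ ⟩
  map (sizeF ts +_) (expsF ts)                         ≡⟨ cong (map (sizeF ts +_)) unitFactors ⟨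
  map (sizeF ts +_) ((0 ∷ []) ⊗ ((0 ∷ []) ⊗ expsF ts)) ∎)
  where
  open ≡-Reasoning
  unitFactors : (0 ∷ []) ⊗ ((0 ∷ []) ⊗ expsF ts) ≡ expsF ts
  unitFactors = trans (⊗-identityˡ _) (⊗-identityˡ (expsF ts))
headPart {n} IH (node ds ∷ cs) ts eq = begin
  concatMap (pluckTerm expsF) (plucksInHead (node (node ds ∷ cs)) ts)
    ↭⟨ concatMap-additive additiveF _ (pluckTerm expsF) (pluckTerm expsF) (plucksF (node ds ∷ cs))
                          (All.map (λ { {r , cs'} → pluckedHead r cs' }) (plucksF-size (node ds ∷ cs))) ⟩
  F (concatMap (pluckTerm expsF) (plucksF (node ds ∷ cs)))
    ≡⟨ cong F (expsF-unfold ds cs) ⟨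
  F (expsF (node ds ∷ cs)) ∎
  where
  open PermutationReasoning
  b = sizeF ts
  A = binom (sizeF (node ds ∷ cs)) b
  F : List ℕ → List ℕ
  F = map (b +_) ∘ (A ⊗_) ∘ (_⊗ expsF ts)
  additiveF : Additive F
  additiveF = additive-∘ (additive-map b) (additive-∘ (additive-⊗ˡ A) (additive-⊗ʳ (expsF ts)))
  pluckedHead : ∀ r cs' → sizeF (node ds ∷ cs) ≡ suc (sizeF cs') →
                map ((r + b) +_) (expsF (node cs' ∷ ts)) ↭ F (map (r +_) (expsF cs'))
  pluckedHead r cs' smaller = begin
    map ((r + b) +_) (expsF (node cs' ∷ ts))
      ↭⟨ map⁺ ((r + b) +_) (IH (node cs') ts sizeEq) ⟩
    map ((r + b) +_) (binom (suc (sizeF cs')) b ⊗ W)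
      ≡⟨ cong (λ k → map ((r + b) +_) (binom k b ⊗ W)) smaller ⟨
    map ((r + b) +_) (A ⊗ W)
      ≡⟨ trans (cong (λ k → map (k +_) (A ⊗ W)) (+-comm r b)) (map-+-assoc b r (A ⊗ W)) ⟩
    map (b +_) (map (r +_) (A ⊗ W))
      ≡⟨ cong (map (b +_)) (trans (map-⊗ʳ r A W) (cong (A ⊗_) (map-⊗ˡ r (expsF cs') (expsF ts)))) ⟩
    F (map (r +_) (expsF cs')) ∎
    where
    W = expsF cs' ⊗ expsF ts
    sizeEq : suc (sizeF cs') + b ≡ n
    sizeEq = suc-injective (trans (cong (λ k → suc k + b) (sym smaller)) eq)

tailPart : ∀ {n} → ProductFormula n → ∀ t ds ss → sizeF (t ∷ node ds ∷ ss) ≡ suc n →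
  concatMap (pluckTerm expsF) (plucksInTail t (node ds ∷ ss))
    ↭ binom (size t) (pred (sizeF (node ds ∷ ss))) ⊗ (exps t ⊗ expsF (node ds ∷ ss))
tailPart {n} IH t ds ss eq = begin
  concatMap (pluckTerm expsF) (plucksInTail t ts)
    ↭⟨ concatMap-additive additiveG _ (pluckTerm expsF) (pluckTerm expsF) (plucksF ts)
                          (All.map (λ { {r , ts'} → pluckedTail r ts' }) (plucksF-size ts)) ⟩
  G (concatMap (pluckTerm expsF) (plucksF ts))
    ≡⟨ cong G (expsF-unfold ds ss) ⟨
  G (expsF ts) ∎
  where
  open PermutationReasoning
  ts = node ds ∷ ss
  A = binom (size t) (pred (sizeF ts))
  G : List ℕ → List ℕ
  G = (A ⊗_) ∘ (exps t ⊗_)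
  additiveG : Additive G
  additiveG = additive-∘ (additive-⊗ˡ A) (additive-⊗ˡ (exps t))
  pluckedTail : ∀ r ts' → sizeF ts ≡ suc (sizeF ts') →
                map (r +_) (expsF (t ∷ ts')) ↭ G (map (r +_) (expsF ts'))
  pluckedTail r ts' smaller = begin
    map (r +_) (expsF (t ∷ ts'))
      ↭⟨ map⁺ (r +_) (IH t ts' sizeEq) ⟩
    map (r +_) (binom (size t) (sizeF ts') ⊗ (exps t ⊗ expsF ts'))
      ≡⟨ cong (λ k → map (r +_) (binom (size t) k ⊗ (exps t ⊗ expsF ts'))) (cong pred smaller) ⟨
    map (r +_) (A ⊗ (exps t ⊗ expsF ts'))
      ≡⟨ trans (map-⊗ʳ r A (exps t ⊗ expsF ts')) (cong (A ⊗_) (map-⊗ʳ r (exps t) (expsF ts'))) ⟩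
    G (map (r +_) (expsF ts')) ∎
    where
    sizeEq : size t + sizeF ts' ≡ n
    sizeEq = suc-injective (trans (sym (+-suc (size t) (sizeF ts'))) (trans (cong (size t +_) (sym smaller)) eq))

-- Induction on the number of vertices: the contributions of the two kinds of
-- leaves add up to the whole by the Pascal rule defining binom (with only the
-- first kind present when ts is empty).
productFormula : ∀ n → ProductFormula n
productFormula zero    (node cs) ts ()
productFormula (suc n) (node cs) [] eq = begin
  expsF (node cs ∷ [])
    ≡⟨ expsF-unfold cs [] ⟩
  concatMap (pluckTerm expsF) (plucksF (node cs ∷ []))
    ≡⟨ cong (concatMap (pluckTerm expsF)) (trans (plucksF-split (node cs) []) (++-identityʳ _)) ⟩
  concatMap (pluckTerm expsF) (plucksInHead (node cs) [])
    ↭⟨ headPart (productFormula n) cs [] eq ⟩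
  map (0 +_) (binom (sizeF cs) 0 ⊗ W)
    ≡⟨ map-id _ ⟩
  binom (sizeF cs) 0 ⊗ W
    ≡⟨ cong (_⊗ W) (binom-zeroʳ (sizeF cs)) ⟩
  binom (suc (sizeF cs)) 0 ⊗ W
    ∎
  where
  open PermutationReasoning
  W = expsF cs ⊗ expsF []
productFormula (suc n) (node cs) (node ds ∷ ss) eq = begin
  expsF (node cs ∷ ts)
    ≡⟨ expsF-unfold cs ts ⟩
  concatMap term (plucksF (node cs ∷ ts))
    ≡⟨ cong (concatMap term) (plucksF-split (node cs) ts) ⟩
  concatMap term (inHead ++ inTail)
    ≡⟨ concatMap-++ term inHead inTail ⟩
  concatMap term inHead ++ concatMap term inTail
    ↭⟨ ++⁺ (headPart (productFormula n) cs ts eq) (tailPart (productFormula n) (node cs) ds ss eq) ⟩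
  map (b +_) (binom a b ⊗ W) ++ binom (suc a) (pred b) ⊗ W
    ≡⟨ cong (_++ binom (suc a) (pred b) ⊗ W) (map-⊗ˡ b (binom a b) W) ⟩
  map (b +_) (binom a b) ⊗ W ++ binom (suc a) (pred b) ⊗ W
    ≡⟨ ⊗-distribʳ (map (b +_) (binom a b)) (binom (suc a) (pred b)) W ⟨
  binom (suc a) b ⊗ W
    ∎
  where
  open PermutationReasoning
  ts = node ds ∷ ss
  a = sizeF cs
  b = sizeF ts
  term = pluckTerm expsF
  inHead = plucksInHead (node cs) ts
  inTail = plucksInTail (node cs) ts
  W = expsF cs ⊗ expsF ts

record Palindromic (M : List ℕ) (D : ℕ) : Set where
  field
    bounded : All (_≤ D) M
    reflect : map (D ∸_) M ↭ M
    hasZero : 0 ∈ M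
open Palindromic

palindromic-resp-↭ : ∀ {X Y D} → X ↭ Y → Palindromic X D → Palindromic Y D
palindromic-resp-↭ {D = D} X↭Y palX = record
  { bounded = All-resp-↭ X↭Y (bounded palX)
  ; reflect = ↭-trans (map⁺ (D ∸_) (↭-sym X↭Y)) (↭-trans (reflect palX) X↭Y)
  ; hasZero = ∈-resp-↭ X↭Y (hasZero palX)
  }

palindromic-one : Palindromic (0 ∷ []) 0
palindromic-one = record { bounded = z≤n ∷ [] ; reflect = ↭-refl ; hasZero = here refl }

reflect-shifted : ∀ k D X → map ((k + D) ∸_) (map (k +_) X) ≡ map (D ∸_) X
reflect-shifted k D X = trans (sym (map-∘ X)) (map-cong ([m+n]∸[m+o]≡n∸o k D) X)

reflect-widened : ∀ k D X → All (_≤ D) X → map ((k + D) ∸_) X ≡ map (k +_) (map (D ∸_) X)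
reflect-widened k D X X≤D = trans (map-cong-local (All.map (+-∸-assoc k) X≤D)) (map-∘ X)

reflect-+ : ∀ {D₁ D₂ x y} → x ≤ D₁ → y ≤ D₂ → (D₁ + D₂) ∸ (x + y) ≡ (D₁ ∸ x) + (D₂ ∸ y)
reflect-+ {D₁} {D₂} {x} {y} x≤D₁ y≤D₂ = begin
  (D₁ + D₂) ∸ (x + y)    ≡⟨ ∸-+-assoc (D₁ + D₂) x y ⟨
  (D₁ + D₂) ∸ x ∸ y      ≡⟨ cong (_∸ y) (+-∸-comm D₂ x≤D₁) ⟩
  (D₁ ∸ x) + D₂ ∸ y      ≡⟨ +-∸-assoc (D₁ ∸ x) y≤D₂ ⟩
  (D₁ ∸ x) + (D₂ ∸ y)    ∎
  where open ≡-Reasoning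

palindromic-⊗ : ∀ {X Y D₁ D₂} → Palindromic X D₁ → Palindromic Y D₂ → Palindromic (X ⊗ Y) (D₁ + D₂)
palindromic-⊗ {X} {Y} {D₁} {D₂} palX palY = record
  { bounded = boundedProduct X (bounded palX)
  ; reflect = begin
      map ((D₁ + D₂) ∸_) (X ⊗ Y)        ≡⟨ reflectProduct X (bounded palX) ⟩
      map (D₁ ∸_) X ⊗ map (D₂ ∸_) Y     ↭⟨ ⊗-congˡ _ (reflect palX) ⟩
      X ⊗ map (D₂ ∸_) Y                 ↭⟨ ⊗-congʳ X (reflect palY) ⟩
      X ⊗ Y                             ∎
  ; hasZero = ∈-cartesianProductWith⁺ _+_ (hasZero palX) (hasZero palY)
  }
  where
  open PermutationReasoning
  boundedProduct : ∀ X → All (_≤ D₁) X → All (_≤ D₁ + D₂) (X ⊗ Y)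
  boundedProduct []      []            = []
  boundedProduct (x ∷ X) (x≤D₁ ∷ X≤D₁) =
    AllP.++⁺ (AllP.map⁺ (All.map (+-mono-≤ x≤D₁) (bounded palY))) (boundedProduct X X≤D₁)
  reflectRow : ∀ {x} → x ≤ D₁ → map ((D₁ + D₂) ∸_) (map (x +_) Y) ≡ map ((D₁ ∸ x) +_) (map (D₂ ∸_) Y)
  reflectRow x≤D₁ =
    trans (sym (map-∘ Y)) (trans (map-cong-local (All.map (reflect-+ x≤D₁) (bounded palY))) (map-∘ Y))
  reflectProduct : ∀ X → All (_≤ D₁) X →
                   map ((D₁ + D₂) ∸_) (X ⊗ Y) ≡ map (D₁ ∸_) X ⊗ map (D₂ ∸_) Y
  reflectProduct []      []            = refl
  reflectProduct (x ∷ X) (x≤D₁ ∷ X≤D₁) = trans (map-++ ((D₁ + D₂) ∸_) (map (x +_) Y) (X ⊗ Y))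
    (cong₂ _++_ (reflectRow x≤D₁) (reflectProduct X X≤D₁))

palindromic-binom : ∀ a b → Palindromic (binom a b) (a * b)
palindromic-binom zero    b    = palindromic-one
palindromic-binom (suc a) zero = subst (Palindromic (0 ∷ [])) (sym (*-zeroʳ (suc a))) palindromic-one
palindromic-binom (suc a) (suc b) = record
  { bounded = AllP.++⁺ (AllP.map⁺ (All.map (+-monoʳ-≤ (suc b)) (bounded left)))
                       (All.map (λ x≤E → ≤-trans x≤E (*-monoʳ-≤ (suc a) (n≤1+n b))) (bounded right))
  ; reflect = begin
      map (D ∸_) (map (suc b +_) X₁ ++ X₂)
        ≡⟨ map-++ (D ∸_) (map (suc b +_) X₁) X₂ ⟩
      map (D ∸_) (map (suc b +_) X₁) ++ map (D ∸_) X₂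
        ≡⟨ cong₂ _++_ (reflect-shifted (suc b) (a * suc b) X₁) reflectRight ⟩
      map (a * suc b ∸_) X₁ ++ map (suc a +_) (map (E ∸_) X₂)
        ↭⟨ ++⁺ (reflect left) (map⁺ (suc a +_) (reflect right)) ⟩
      X₁ ++ map (suc a +_) X₂
        ↭⟨ binom-pascalᵒ a b ⟨
      binom (suc a) (suc b)
        ∎
  ; hasZero = ∈-++⁺ʳ _ (hasZero right)
  }
  where
  open PermutationReasoning
  X₁ = binom a (suc b)
  X₂ = binom (suc a) b
  D = suc a * suc b
  E = suc a * b
  left : Palindromic X₁ (a * suc b)
  left = palindromic-binom a (suc b)
  right : Palindromic X₂ E
  right = palindromic-binom (suc a) b
  reflectRight : map (D ∸_) X₂ ≡ map (suc a +_) (map (E ∸_) X₂)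
  reflectRight =
    trans (cong (λ k → map (k ∸_) X₂) (*-suc (suc a) b)) (reflect-widened (suc a) E X₂ (bounded right))

-- By the product formula, the exponents of every plucking polynomial form a
-- palindromic multiset.
palindromic-exps : ∀ ts → ∃ λ D → Palindromic (expsF ts) D
palindromic-exps []             = 0 , palindromic-one
palindromic-exps (node cs ∷ ts) with palindromic-exps cs | palindromic-exps ts
... | _ , palCs | _ , palTs =
  _ , palindromic-resp-↭ (↭-sym (productFormula _ (node cs) ts refl))
                         (palindromic-⊗ (palindromic-binom (size (node cs)) (sizeF ts)) (palindromic-⊗ palCs palTs))

palindromic-count : ∀ {M D} → Palindromic M D → ∀ {j} → j ≤ D → count j M ≡ count (D ∸ j) M
palindromic-count {M} palM {j} j≤D =
  trans (count-resp-↭ j (↭-sym (reflect palM))) (count-reflect M (bounded palM) j≤D)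

palindromic-degree : ∀ {P M D N} → Represents P M → Palindromic M D → IsDegree P N → N ≡ D
palindromic-degree {M = M} {D} {N} P~M palM (coeffN≢0 , coeffAbove≡0) = ≤-antisym N≤D D≤N
  where
  countD≢0 : count D M ≢ 0
  countD≢0 countD≡0 = count-present (hasZero palM)
    (trans (cong (λ k → count k M) (sym (n∸n≡0 D))) (trans (sym (palindromic-count palM ≤-refl)) countD≡0))
  N≤D : N ≤ D
  N≤D with N ≤? D
  ... | yes N≤D = N≤D
  ... | no  N≰D = contradiction (trans (coeff≡count P~M N) (cong pos countN≡0)) coeffN≢0
    where
    notBelow : ∀ {x} → x ≤ D → N ≢ x
    notBelow x≤D refl = N≰D x≤D
    countN≡0 : count N M ≡ 0
    countN≡0 = count-absent M (All.map notBelow (bounded palM))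
  D≤N : D ≤ N
  D≤N with D ≤? N
  ... | yes D≤N = D≤N
  ... | no  D≰N = contradiction countD≡0 countD≢0
    where
    countD≡0 : count D M ≡ 0
    countD≡0 = +-injective (trans (sym (coeff≡count P~M D)) (coeffAbove≡0 D (≰⇒> D≰N)))

corollary2p4 : (T : Tree) (N : ℕ) → IsDegree (Q T) N →
               ∀ i → i ≤ N → coeff (Q T) i ≡ coeff (Q T) (N ∸ i)
corollary2p4 (node ts) N isDegree i i≤N with palindromic-exps ts
... | D , palM = begin
  coeff (Q (node ts)) i     ≡⟨ coeff≡count Q~M i ⟩
  pos (count i M)           ≡⟨ cong pos (palindromic-count palM (subst (i ≤_) N≡D i≤N)) ⟩
  pos (count (D ∸ i) M)     ≡⟨ cong (λ k → pos (count (k ∸ i) M)) N≡D ⟨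
  pos (count (N ∸ i) M)     ≡⟨ coeff≡count Q~M (N ∸ i) ⟨
  coeff (Q (node ts)) (N ∸ i) ∎
  where
  open ≡-Reasoning
  M = expsF ts
  Q~M : Represents (Q (node ts)) M
  Q~M = represents-Qfuel (sizeF ts) ts
  N≡D : N ≡ D
  N≡D = palindromic-degree Q~M palM isDegree
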